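{- For every integer $n\ge 1$, the string $\underbrace{1\cdots1}_{n}0$ ($n$ ones followed by a single $0$) is a code.
   Context: Code: let $x=a_na_{n-1}\dots a_1a_0$ be a positive integer with $n+1\ge 2$ decimal digits and $a_n>a_0$. Its code is the string $z_0z_1\dots z_n$ of $0$s and $1$s defined by setting $z_{ -1}=0$, and for $i=0,\dots,n-1$: $z_i=1$ if $a_i-a_{n-i}-z_{i-1}<0$ and $z_i=0$ otherwise; and $z_n=0$. (Thus $z_i$ records whether a borrow from position $i+1$ occurs at position $i$ in the column subtraction of the reverse $x'=a_0a_1\dots a_n$ from $x$; in particular $z_0=1$.) A finite string of $0$s and $1$s is called a code if it is the code of some such integer $x$. -}

module Defs where

open import Data.Nat using (ℕ; zero; suc; _∸_; _<_)
open import Data.Fin using (Fin; toℕ; fromℕ; opposite) renaming (zero to fzero)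
open import Data.Bool using (Bool; true; false)
open import Data.List using (List; []; _∷_; _++_; replicate)
open import Data.Integer using (ℤ; +_; _-_)
open import Data.Integer.Properties using () renaming (_<?_ to _<ℤ?_)
open import Data.Product using (Σ; _×_)
open import Relation.Nullary using (does)
open import Relation.Binary.PropositionalEquality using (_≡_)

-- A positive integer x = a_n a_{n-1} ... a_1 a_0 with n+1 decimal digits is
-- represented by its digit function  a : Fin (suc n) → ℕ,  a i = a_i
-- (the coefficient of 10^i).

-- Such a digit function is admissible when n + 1 ≥ 2 (i.e. n ≥ 1), every
-- digit is < 10 and a_n > a_0 (which also makes the leading digit nonzero).
Admissible : (n : ℕ) → (Fin (suc n) → ℕ) → Set
Admissible n a = (0 < n) × ((i : Fin (suc n)) → a i < 10) × (a fzero < a (fromℕ n))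

b2ℤ : Bool → ℤ
b2ℤ true  = + 1
b2ℤ false = + 0

zbit : (n : ℕ) → (Fin (suc n) → ℕ) → Fin (suc n) → Bool → Bool
zbit n a i prev = does (((+ a i) - (+ a (opposite i))) - b2ℤ prev <ℤ? + 0)

-- go n a i prev k  computes  z_i, z_{i+1}, ..., z_{i+k-1}  given z_{i-1} = prev,
-- with index i given as a natural number (all used indices are ≤ n - 1).
safeIx : (n : ℕ) → ℕ → Fin (suc n)
safeIx zero    _       = fzero
safeIx (suc n) zero    = fzero
safeIx (suc n) (suc i) = Data.Fin.suc (safeIx n i)

go : (n : ℕ) → (Fin (suc n) → ℕ) → ℕ → Bool → ℕ → List Bool
go n a i prev zero    = []
go n a i prev (suc k) = let zi = zbit n a (safeIx n i) prev in zi ∷ go n a (suc i) zi k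

-- The code z_0 z_1 ... z_n  (with z_{-1} = 0 and z_n = 0), as a list of
-- Booleans (true = 1, false = 0) of length n+1.
code : (n : ℕ) → (Fin (suc n) → ℕ) → List Bool
code n a = go n a 0 false n ++ (false ∷ [])

IsCode : List Bool → Set
IsCode s = Σ ℕ λ n → Σ (Fin (suc n) → ℕ) λ a → Admissible n a × (code n a ≡ s)

-- The witness is x = 10^n, with digits a_n = 1 and a_i = 0 otherwise. At i = 0 the
-- column reads 0 - 1 < 0, so a borrow starts; every later column reads 0 - a_{n-i} - 1 < 0,
-- so the borrow propagates through all of z_0 … z_{n-1}, and z_n = 0 by definition.
module Submission where

open import Defs
open import Data.Nat using (ℕ; _≥_; zero; suc; _+_; _≤_; _<_; s≤s; z≤n)
open import Data.Nat.Properties using (+-suc; ≤-refl; m+n≤o⇒m≤o)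
open import Data.Bool using (true; false)
open import Data.List using ([]; _∷_; _++_; replicate)
open import Data.Fin using (Fin; fromℕ; opposite) renaming (zero to fzero; suc to fsuc)
open import Data.Integer using (+_; _-_; -<+) renaming (_<_ to _<ℤ_)
open import Data.Integer.Properties using () renaming (_<?_ to _<ℤ?_)
open import Data.Product using (_,_)
open import Relation.Nullary.Decidable using (dec-true)
open import Relation.Binary.PropositionalEquality using (_≡_; refl; cong; sym; subst)

digits-10^ : (n : ℕ) → Fin (suc n) → ℕ
digits-10^ zero    fzero    = 1
digits-10^ (suc n) fzero    = 0
digits-10^ (suc n) (fsuc i) = digits-10^ n i

digits-10^-fromℕ : ∀ n → digits-10^ n (fromℕ n) ≡ 1
digits-10^-fromℕ zero    = refl
digits-10^-fromℕ (suc n) = digits-10^-fromℕ n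

digits-10^-<10 : ∀ n i → digits-10^ n i < 10
digits-10^-<10 zero    fzero    = s≤s (s≤s z≤n)
digits-10^-<10 (suc n) fzero    = s≤s z≤n
digits-10^-<10 (suc n) (fsuc i) = digits-10^-<10 n i

digits-10^-safeIx : ∀ n i → i < n → digits-10^ n (safeIx n i) ≡ 0
digits-10^-safeIx (suc n) zero    _         = refl
digits-10^-safeIx (suc n) (suc i) (s≤s i<n) = digits-10^-safeIx n i i<n

admissible-10^ : ∀ n → 0 < n → Admissible n (digits-10^ n)
admissible-10^ (suc m) 0<n =
  0<n , digits-10^-<10 (suc m) , subst (0 <_) (sym (digits-10^-fromℕ m)) (s≤s z≤n)

zero-minus-borrow<0 : ∀ x → (+ 0 - + x) - + 1 <ℤ + 0
zero-minus-borrow<0 zero    = -<+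
zero-minus-borrow<0 (suc x) = -<+

zbit-zero-digit-borrows : ∀ n a i → a i ≡ 0 → zbit n a i true ≡ true
zbit-zero-digit-borrows n a i aᵢ≡0 rewrite aᵢ≡0 =
  dec-true (_ <ℤ? _) (zero-minus-borrow<0 (a (opposite i)))

go-borrow-propagates : ∀ n a → (∀ j → j < n → a (safeIx n j) ≡ 0) →
                       ∀ i k → i + k ≤ n → go n a i true k ≡ replicate k true
go-borrow-propagates n a zero-below i zero    _     = refl
go-borrow-propagates n a zero-below i (suc k) i+k<n with subst (_≤ n) (+-suc i k) i+k<n
... | 1+i+k≤n rewrite zbit-zero-digit-borrows n a (safeIx n i) (zero-below i (m+n≤o⇒m≤o (suc i) 1+i+k≤n)) =
  cong (true ∷_) (go-borrow-propagates n a zero-below (suc i) k 1+i+k≤n)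

code-10^ : ∀ n → 0 < n → code n (digits-10^ n) ≡ replicate n true ++ (false ∷ [])
code-10^ (suc m) _
  rewrite digits-10^-fromℕ m
        | go-borrow-propagates (suc m) (digits-10^ (suc m)) (digits-10^-safeIx (suc m)) 1 m ≤-refl
  = refl

proposition7 : (n : ℕ) → n ≥ 1 → IsCode (replicate n true ++ (false ∷ []))
proposition7 n n≥1 = n , digits-10^ n , admissible-10^ n n≥1 , code-10^ n n≥1
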